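{- Let $H$ be an ordered graph on $h$ vertices and $r:=\chi_<(H)$. Then $\chi^*_{cr}(H)\geq (r-1)+\frac{r-1}{h-1}$.
   Context: An ordered graph on $h$ vertices is a graph with vertex set $[h]$ (ordered naturally); containment of ordered graphs requires an order-preserving edge-preserving injection. An interval $r$-colouring of $H$ is a partition of $[h]$ into $r$ intervals $V_1<\dots<V_r$ with no edge inside any interval; $\chi_<(H)$ is the least such $r$. An $H$-tiling is a collection of vertex-disjoint copies of $H$; perfect if it covers all vertices. For sets of integers, $X<Y$ means $a<b$ for all $a\in X,b\in Y$. For a complete $k$-partite unordered graph $B$ with parts $U_1,\dots,U_k$ and a permutation $\sigma$ of $[k]$, an interval labelling w.r.t. $\sigma$ is a bijection $\phi:V(B)\to[|B|]$ with $\phi(U_i)<\phi(U_j)$ when $\sigma(i)<\sigma(j)$; the ordered blow-up $(B(t),\phi)$ replaces each vertex $x$ by $t$ independent vertices $V_x$ (complete bipartite between $V_x,V_y$ when $xy\in E(B)$) ordered so that $V_x<V_y$ when $\phi(x)<\phi(y)$. $B$ is a bottlegraph of $H$ if for every such $\sigma,\phi$ there is $t$ with $(B(t),\phi)$ containing a perfect $H$-tiling. $\chi_{cr}(F)=(\chi(F)-1)|F|/(|F|-\sigma(F))$ for unordered $F$, with $\sigma(F)$ the least size of a colour class over proper $\chi(F)$-colourings; $\chi^*_{cr}(H)=\inf\{\chi_{cr}(B): B \text{ a bottlegraph of } H\}$. -}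

module Defs where

open import Data.Nat using (ℕ; _*_; _∸_) renaming (_≤_ to _≤ℕ_)
open import Data.Fin using (Fin; _<_; _≤_; quotient; _≟_)
open import Data.Fin.Permutation using (Permutation′; _⟨$⟩ʳ_; _⟨$⟩ˡ_)
open import Data.List using (length; filter; allFin)
open import Data.Product using (Σ; ∃; ∃-syntax; _×_; _,_)
open import Relation.Binary.PropositionalEquality using (_≡_; _≢_; sym)
open import Relation.Nullary using (¬_)

-- A (simple) graph on vertex set Fin size.  When regarded as an ORDERED
-- graph, the vertex order is the natural order of Fin size (i.e. [h]).
record Graph : Set₁ where
  field
    size    : ℕ
    adj     : Fin size → Fin size → Set
    adj-sym : ∀ {a b} → adj a b → adj b a
    adj-irr : ∀ {a} → ¬ adj a a
open Graph public

-- An interval r-colouring: a non-decreasing surjective map c : [h] → [r]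
-- (so the classes c⁻¹(1) < … < c⁻¹(r) are r nonempty intervals
-- partitioning [h]) with no edge inside a class.
IntervalColouring : (H : Graph) → ℕ → Set
IntervalColouring H r =
  Σ (Fin (size H) → Fin r) λ c →
    (∀ a b → a ≤ b → c a ≤ c b) ×
    (∀ j → ∃[ a ] c a ≡ j) ×
    (∀ a b → adj H a b → c a ≢ c b)

IsIntervalChromaticNumber : Graph → ℕ → Set
IsIntervalChromaticNumber H r =
  IntervalColouring H r × (∀ r′ → IntervalColouring H r′ → r ≤ℕ r′)

ProperColouring : (F : Graph) → ℕ → Set
ProperColouring F k =
  Σ (Fin (size F) → Fin k) λ c → ∀ a b → adj F a b → c a ≢ c b

classSize : ∀ {n k} → (Fin n → Fin k) → Fin k → ℕ
classSize {n} c j = length (filter (λ v → c v ≟ j) (allFin n))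

IsChromaticNumber : Graph → ℕ → Set
IsChromaticNumber F χ =
  ProperColouring F χ × (∀ k → ProperColouring F k → χ ≤ℕ k)

IsSigma : Graph → (χ s : ℕ) → Set
IsSigma F χ s =
  (Σ (ProperColouring F χ) λ { (c , _) → ∃[ j ] classSize c j ≡ s }) ×
  (∀ (pc : ProperColouring F χ) → ∀ j → s ≤ℕ classSize (Σ.proj₁ pc) j)

CompleteMultipartite : (n k : ℕ) → (Fin n → Fin k) → Graph
CompleteMultipartite n k part = record
  { size = n
  ; adj = λ u v → part u ≢ part v
  ; adj-sym = λ p e → p (sym e)
  ; adj-irr = λ p → p _≡_.refl
  }

IsIntervalLabelling : ∀ {n k} → (Fin n → Fin k) →
                      Permutation′ k → Permutation′ n → Set
IsIntervalLabelling part σ φ =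
  ∀ u v → (σ ⟨$⟩ʳ part u) < (σ ⟨$⟩ʳ part v) → (φ ⟨$⟩ʳ u) < (φ ⟨$⟩ʳ v)

-- Ordered blow-up (B(t), φ): vertex i of [n·t] lies in the block V_x with
-- x = φ⁻¹(⌊i / t⌋); so V_x < V_y whenever φ(x) < φ(y).
BlowUp : (n k : ℕ) → (Fin n → Fin k) → Permutation′ n → (t : ℕ) → Graph
BlowUp n k part φ t = record
  { size = n * t
  ; adj = λ i j → part (φ ⟨$⟩ˡ quotient t i) ≢ part (φ ⟨$⟩ˡ quotient t j)
  ; adj-sym = λ p e → p (sym e)
  ; adj-irr = λ p → p _≡_.refl
  }

IsOrderedEmbedding : (H G : Graph) → (Fin (size H) → Fin (size G)) → Set
IsOrderedEmbedding H G f =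
  (∀ a b → a < b → f a < f b) × (∀ a b → adj H a b → adj G (f a) (f b))

PerfectTiling : (H G : Graph) → Set
PerfectTiling H G =
  Σ ℕ λ m → Σ (Fin m → Fin (size H) → Fin (size G)) λ f →
    (∀ i → IsOrderedEmbedding H G (f i)) ×
    (∀ i j a b → f i a ≡ f j b → (i ≡ j × a ≡ b)) ×
    (∀ v → ∃[ i ] ∃[ a ] f i a ≡ v)

IsBottlegraph : (H : Graph) (n k : ℕ) → (Fin n → Fin k) → Set
IsBottlegraph H n k part =
  ∀ (σ : Permutation′ k) (φ : Permutation′ n) → IsIntervalLabelling part σ φ →
    ∃[ t ] (1 ≤ℕ t × PerfectTiling H (BlowUp n k part φ t))

-- Fix an optimal colouring of the bottlegraph B with a colour class of size s = σ(B).  It is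
-- constant on the parts of B, so listing parts and vertices by colour is an interval labelling,
-- and B(t) has a perfect H-tiling.  Each copy of H inherits from the blocks of B(t) a colouring
-- whose classes are intervals, so r ≤ χ(B).  If χ(B) = r, a copy missing a colour would give an
-- interval colouring with fewer than r colours; so every copy meets the s·t vertices of the
-- smallest class, whence n·t ≤ (number of copies)·h ≤ s·t·h, i.e. n ≤ s h, which rearranges to
-- the bound.  If χ(B) > r the bound already follows from r ≤ h.
module Submission where

open import Defs

open import Data.Nat using (ℕ; _*_; _∸_; _≤_)
open import Data.Fin using (Fin)

open import Data.Empty using (⊥-elim)
open import Data.Fin as Fin
  using ( zero; suc; toℕ; fromℕ; fromℕ<; punchIn; punchOut
        ; quotient; remainder; remQuot; combine; _≟_ )
open import Data.Fin.Permutation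
  using (Permutation′; _⟨$⟩ʳ_; _⟨$⟩ˡ_; id; insert; insert-punchIn; inverseʳ)
open import Data.Fin.Properties
  using ( punchIn-punchOut; punchIn-mono-≤; punchIn-injective; punchInᵢ≢i
        ; punchOut-mono-≤; punchOut-injective; ≤fromℕ; ≤∧≢⇒<; <⇒≢; any?; all?; ¬∀⟶∃¬
        ; combine-injective; combine-remQuot; combine-monoˡ-<; injective⇒≤ )
open import Data.List using (List; filter; allFin; lookup)
open import Data.List.Membership.Propositional using (_∈_)
open import Data.List.Membership.Propositional.Properties using (∈-filter⁺; ∈-allFin)
import Data.List.Relation.Unary.Any as Any
open import Data.List.Relation.Unary.Any.Properties using (lookup-index)
open import Data.Nat as ℕ using (zero; suc; z≤n; s≤s; _+_; _<_; _≤?_; >-nonZero)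
open import Data.Nat.Properties hiding (_≟_; ≤∧≢⇒<; <⇒≢)
open import Data.Product using (Σ; ∃-syntax; _×_; _,_; proj₁; proj₂; uncurry)
open import Data.Sum using (_⊎_; inj₁; inj₂; map₂)
open import Function using (_∘_)
open import Relation.Binary.PropositionalEquality
open import Relation.Nullary using (yes; no)
open import Relation.Nullary.Decidable using (decidable-stable)

SortedBy : ∀ {n} → (Fin n → ℕ) → Permutation′ n → Set
SortedBy key π = ∀ u v → key u < key v → π ⟨$⟩ʳ u Fin.< π ⟨$⟩ʳ v

SortedBy-reflects-≤ : ∀ {n} {key : Fin n → ℕ} {π : Permutation′ n} → SortedBy key π →
                      ∀ u v → π ⟨$⟩ʳ u Fin.≤ π ⟨$⟩ʳ v → key u ≤ key v
SortedBy-reflects-≤ sorted u v πu≤πv = ≮⇒≥ λ kv<ku → <⇒≱ (sorted v u kv<ku) πu≤πv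

maximiser : ∀ {n} (key : Fin (suc n) → ℕ) → ∃[ u ] ∀ v → key v ≤ key u
maximiser {zero} key = zero , λ { zero → ≤-refl }
maximiser {suc n} key with maximiser (key ∘ suc)
... | w , w-max with key zero ≤? key (suc w)
... | yes k₀≤kw = suc w , λ { zero → k₀≤kw ; (suc v) → w-max v }
... | no k₀≰kw = zero , λ { zero → ≤-refl ; (suc v) → ≤-trans (w-max v) (<⇒≤ (≰⇒> k₀≰kw)) }

punchIn-mono-< : ∀ {n} i (a b : Fin n) → a Fin.< b → punchIn i a Fin.< punchIn i b
punchIn-mono-< i a b a<b =
  ≤∧≢⇒< (punchIn-mono-≤ i a b (<⇒≤ a<b)) (λ eq → <⇒≢ a<b (punchIn-injective i a b eq))

insert-pivot : ∀ {m} (i j : Fin (suc m)) (π : Permutation′ m) → insert i j π ⟨$⟩ʳ i ≡ j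
insert-pivot i j π with i ≟ i
... | yes _ = refl
... | no i≢i = ⊥-elim (i≢i refl)

data PivotView {n} (p : Fin (suc n)) : Fin (suc n) → Set where
  pivot : PivotView p p
  other : ∀ i → PivotView p (punchIn p i)

pivotView : ∀ {n} (p u : Fin (suc n)) → PivotView p u
pivotView p u with p ≟ u
... | yes refl = pivot
... | no p≢u = subst (PivotView p) (punchIn-punchOut p≢u) (other (punchOut p≢u))

-- Selection sort: a vertex of maximal key goes last, the rest are sorted recursively.
sortingPermutation : ∀ n (key : Fin n → ℕ) → Σ (Permutation′ n) (SortedBy key)
sortingPermutation zero key = id , λ ()
sortingPermutation (suc n) key with maximiser key
... | u₀ , u₀-max with sortingPermutation n (key ∘ punchIn u₀)
... | π′ , π′-sorted = π , sorted
  where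
  π : Permutation′ (suc n)
  π = insert u₀ (fromℕ n) π′

  sorted : SortedBy key π
  sorted u v ku<kv with pivotView u₀ u | pivotView u₀ v
  ... | pivot | pivot = ⊥-elim (<-irrefl refl ku<kv)
  ... | pivot | other v′ = ⊥-elim (<-irrefl refl (<-≤-trans ku<kv (u₀-max _)))
  ... | other u′ | pivot
    rewrite insert-punchIn u₀ (fromℕ n) π′ u′ | insert-pivot u₀ (fromℕ n) π′ =
      ≤∧≢⇒< (≤fromℕ _) (punchInᵢ≢i _ _)
  ... | other u′ | other v′
    rewrite insert-punchIn u₀ (fromℕ n) π′ u′ | insert-punchIn u₀ (fromℕ n) π′ v′ =
      punchIn-mono-< (fromℕ n) _ _ (π′-sorted u′ v′ ku<kv)

MonotoneColouring : Graph → ℕ → Set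
MonotoneColouring H j =
  Σ (ProperColouring H j) λ pc → ∀ a b → a Fin.≤ b → proj₁ pc a Fin.≤ proj₁ pc b

omitColour : ∀ {F j} (pc : ProperColouring F (suc j)) {q} → (∀ a → q ≢ proj₁ pc a) →
             ProperColouring F j
omitColour (c , proper) q∉ =
  (λ a → punchOut (q∉ a)) , λ a b ab eq → proper a b ab (punchOut-injective (q∉ a) (q∉ b) eq)

omitMonotoneColour : ∀ {H j} (mc : MonotoneColouring H (suc j)) {q} →
                     (∀ a → q ≢ proj₁ (proj₁ mc) a) → MonotoneColouring H j
omitMonotoneColour {H} (pc , mono) q∉ =
  omitColour {H} pc q∉ , λ a b a≤b → punchOut-mono-≤ (q∉ a) (q∉ b) (mono a b a≤b)

-- Dropping the unused colours one at a time makes the colouring surjective.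
monotone⇒intervalColouring : ∀ {H} j → MonotoneColouring H j →
                             ∃[ j′ ] j′ ≤ j × IntervalColouring H j′
monotone⇒intervalColouring zero ((c , proper) , mono) = zero , z≤n , c , mono , (λ ()) , proper
monotone⇒intervalColouring {H} (suc j) mc@((c , proper) , mono)
  with all? (λ q → any? {n = size H} (λ a → c a ≟ q))
... | yes surjective = suc j , ≤-refl , c , mono , surjective , proper
... | no ¬surjective with ¬∀⟶∃¬ _ _ (λ q → any? (λ a → c a ≟ q)) ¬surjective
... | q , q∉
  with monotone⇒intervalColouring {H} j (omitMonotoneColour {H} mc λ a eq → q∉ (a , sym eq))
... | j′ , j′≤j , ic = j′ , m≤n⇒m≤1+n j′≤j , ic

IsIntervalChromaticNumber⇒≤ : ∀ {H r j} → IsIntervalChromaticNumber H r →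
                              MonotoneColouring H j → r ≤ j
IsIntervalChromaticNumber⇒≤ {H} (_ , minimal) mc with monotone⇒intervalColouring {H} _ mc
... | j′ , j′≤j , ic = ≤-trans (minimal j′ ic) j′≤j

IsIntervalChromaticNumber⇒<-omitting : ∀ {H r j} → IsIntervalChromaticNumber H r →
  (mc : MonotoneColouring H j) {q : Fin j} → (∀ a → q ≢ proj₁ (proj₁ mc) a) → r < j
IsIntervalChromaticNumber⇒<-omitting {H} {j = suc j} χ<H mc q∉ =
  s≤s (IsIntervalChromaticNumber⇒≤ {H} {j = j} χ<H (omitMonotoneColour {H} mc q∉))

IsIntervalChromaticNumber⇒≤size : ∀ {H r} → IsIntervalChromaticNumber H r → r ≤ size H
IsIntervalChromaticNumber⇒≤size {H} (_ , minimal) = minimal (size H) identity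
  where
  identity : IntervalColouring H (size H)
  identity = (λ a → a) , (λ _ _ a≤b → a≤b) , (λ b → b , refl) ,
             (λ a b ab a≡b → adj-irr H (subst (adj H a) (sym a≡b) ab))

module _ {n k : ℕ} (part : Fin n → Fin k) where

  sameColour⇒samePart : ∀ {χ} (pc : ProperColouring (CompleteMultipartite n k part) χ) {x y} →
                        proj₁ pc x ≡ proj₁ pc y → part x ≡ part y
  sameColour⇒samePart (c , proper) {x} {y} cx≡cy =
    decidable-stable (part x ≟ part y) (λ x≁y → proper x y x≁y cx≡cy)

  -- Recolour the colour class of v with the colour of u; the colour of v is then unused.
  mergeColours : ∀ {χ} (pc : ProperColouring (CompleteMultipartite n k part) (suc χ)) {u v} →
                 part u ≡ part v → proj₁ pc u ≢ proj₁ pc v →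
                 ProperColouring (CompleteMultipartite n k part) χ
  mergeColours {χ} pc@(c , proper) {u} {v} u~v cu≢cv =
    omitColour {CompleteMultipartite n k part} (merged , merged-proper) avoids
    where
    merged : Fin n → Fin (suc χ)
    merged w with c w ≟ c v
    ... | yes _ = c u
    ... | no _ = c w

    avoids : ∀ w → c v ≢ merged w
    avoids w with c w ≟ c v
    ... | yes _ = cu≢cv ∘ sym
    ... | no cw≢cv = cw≢cv ∘ sym

    merged-colourOfSamePart : ∀ w → ∃[ x ] part x ≡ part w × merged w ≡ c x
    merged-colourOfSamePart w with c w ≟ c v
    ... | yes cw≡cv = u , trans u~v (sym (sameColour⇒samePart pc cw≡cv)) , refl
    ... | no _ = w , refl , refl

    merged-proper : ∀ a b → part a ≢ part b → merged a ≢ merged b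
    merged-proper a b a≁b ma≡mb with merged-colourOfSamePart a | merged-colourOfSamePart b
    ... | x , x~a , ma≡cx | y , y~b , mb≡cy = a≁b (begin
      part a ≡⟨ x~a ⟨
      part x ≡⟨ sameColour⇒samePart pc (trans (sym ma≡cx) (trans ma≡mb mb≡cy)) ⟩
      part y ≡⟨ y~b ⟩
      part b ∎)
      where open ≡-Reasoning

  optimalColouring-constantOnParts : ∀ {χ} → IsChromaticNumber (CompleteMultipartite n k part) χ →
    (pc : ProperColouring (CompleteMultipartite n k part) χ) →
    ∀ {u v} → part u ≡ part v → proj₁ pc u ≡ proj₁ pc v
  optimalColouring-constantOnParts {zero} _ (c , _) {u} _ with c u
  ... | ()
  optimalColouring-constantOnParts {suc χ} (_ , minimal) pc@(c , _) {u} {v} u~v with c u ≟ c v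
  ... | yes cu≡cv = cu≡cv
  ... | no cu≢cv = ⊥-elim (1+n≰n (minimal χ (mergeColours pc u~v cu≢cv)))

  -- Optimal colourings are constant on parts, so sorting the parts by colour is consistent with
  -- sorting the vertices by colour.
  colourSortedLabelling : ∀ {χ} → IsChromaticNumber (CompleteMultipartite n k part) χ →
    (pc : ProperColouring (CompleteMultipartite n k part) χ) →
    ∃[ σ ] ∃[ φ ] IsIntervalLabelling part σ φ ×
                  (∀ x y → φ ⟨$⟩ʳ x Fin.≤ φ ⟨$⟩ʳ y → proj₁ pc x Fin.≤ proj₁ pc y)
  colourSortedLabelling χB pc@(c , proper) =
    σ , φ , labelling , SortedBy-reflects-≤ {key = toℕ ∘ c} {φ} φ-sorted
    where
    φ : Permutation′ n
    φ = proj₁ (sortingPermutation n (toℕ ∘ c))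
    φ-sorted : SortedBy (toℕ ∘ c) φ
    φ-sorted = proj₂ (sortingPermutation n (toℕ ∘ c))

    partColour : Fin k → ℕ
    partColour p with any? (λ u → part u ≟ p)
    ... | yes (u , _) = toℕ (c u)
    ... | no _ = 0

    partColour-part : ∀ u → partColour (part u) ≡ toℕ (c u)
    partColour-part u with any? (λ w → part w ≟ part u)
    ... | yes (w , w~u) = cong toℕ (optimalColouring-constantOnParts χB pc w~u)
    ... | no ∄ = ⊥-elim (∄ (u , refl))

    σ : Permutation′ k
    σ = proj₁ (sortingPermutation k partColour)
    σ-sorted : SortedBy partColour σ
    σ-sorted = proj₂ (sortingPermutation k partColour)

    labelling : IsIntervalLabelling part σ φ
    labelling u v σu<σv = φ-sorted u v (≤∧≢⇒< cu≤cv (proper u v u≁v))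
      where
      cu≤cv : c u Fin.≤ c v
      cu≤cv = subst₂ _≤_ (partColour-part u) (partColour-part v)
                (SortedBy-reflects-≤ {key = partColour} {σ} σ-sorted _ _ (<⇒≤ σu<σv))
      u≁v : part u ≢ part v
      u≁v u~v = <-irrefl (cong (toℕ ∘ (σ ⟨$⟩ʳ_)) u~v) σu<σv

classMembers : ∀ {n k} → (Fin n → Fin k) → Fin k → List (Fin n)
classMembers c j = filter (λ v → c v ≟ j) (allFin _)

∈-classMembers : ∀ {n k} (c : Fin n → Fin k) {j x} → c x ≡ j → x ∈ classMembers c j
∈-classMembers c {j} {x} = ∈-filter⁺ (λ v → c v ≟ j) (∈-allFin x)

classIndex : ∀ {n k} (c : Fin n → Fin k) {j x} → c x ≡ j → Fin (classSize c j)
classIndex c cx≡j = Any.index (∈-classMembers c cx≡j)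

classIndex-injective : ∀ {n k} (c : Fin n → Fin k) {j x y} (p : c x ≡ j) (q : c y ≡ j) →
                       classIndex c p ≡ classIndex c q → x ≡ y
classIndex-injective c {j} {x} {y} p q eq = begin
  x                                          ≡⟨ lookup-index (∈-classMembers c p) ⟩
  lookup (classMembers c j) (classIndex c p) ≡⟨ cong (lookup (classMembers c j)) eq ⟩
  lookup (classMembers c j) (classIndex c q) ≡⟨ lookup-index (∈-classMembers c q) ⟨
  y                                          ∎
  where open ≡-Reasoning

remQuot-injective : ∀ {m} n {v w : Fin (m * n)} → remQuot {m} n v ≡ remQuot n w → v ≡ w
remQuot-injective {m} n {v} {w} eq = begin
  v                                 ≡⟨ combine-remQuot {m} n v ⟨
  uncurry combine (remQuot {m} n v) ≡⟨ cong (uncurry combine) eq ⟩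
  uncurry combine (remQuot {m} n w) ≡⟨ combine-remQuot {m} n w ⟩
  w                                 ∎
  where open ≡-Reasoning

quotient-mono : ∀ {n} t (v w : Fin (n * t)) → v Fin.≤ w → quotient {n} t v Fin.≤ quotient t w
quotient-mono {n} t v w v≤w = ≮⇒≥ λ qw<qv →
  <⇒≱ (subst₂ Fin._<_ (combine-remQuot {n} t w) (combine-remQuot {n} t v)
         (combine-monoˡ-< (remainder {n} t w) (remainder {n} t v) qw<qv)) v≤w

IsOrderedEmbedding⇒mono-≤ : ∀ {H G f} → IsOrderedEmbedding H G f →
                            ∀ a b → a Fin.≤ b → f a Fin.≤ f b
IsOrderedEmbedding⇒mono-≤ (strict , _) a b a≤b with a ≟ b
... | yes refl = ≤-refl
... | no a≢b = <⇒≤ (strict a b (≤∧≢⇒< a≤b a≢b))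

perfectTiling-size : ∀ {H G} (T : PerfectTiling H G) → size G ≤ proj₁ T * size H
perfectTiling-size {H} {G} (m , f , _ , _ , covers) = injective⇒≤ {f = code} code-injective
  where
  code : Fin (size G) → Fin (m * size H)
  code v = combine (proj₁ (covers v)) (proj₁ (proj₂ (covers v)))
  code-injective : ∀ {v w} → code v ≡ code w → v ≡ w
  code-injective {v} {w} eq =
    let i≡j , a≡b = combine-injective _ _ _ _ eq
    in trans (sym (proj₂ (proj₂ (covers v)))) (trans (cong₂ f i≡j a≡b) (proj₂ (proj₂ (covers w))))

perfectTiling-copies≤hittingSet : ∀ {H G N} (T : PerfectTiling H G) (P : Fin (size G) → Set)
  (code : ∀ v → P v → Fin N) → (∀ {v w} p q → code v p ≡ code w q → v ≡ w) →
  (∀ i → ∃[ a ] P (proj₁ (proj₂ T) i a)) → proj₁ T ≤ N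
perfectTiling-copies≤hittingSet (m , f , _ , disjoint , _) P code code-injective meets =
  injective⇒≤ {f = λ i → code _ (proj₂ (meets i))}
    λ eq → proj₁ (disjoint _ _ _ _ (code-injective _ _ eq))

block : ∀ {n} t → Permutation′ n → Fin (n * t) → Fin n
block {n} t φ w = φ ⟨$⟩ˡ quotient {n} t w

module ColourSortedBlowUp
  {H : Graph} {r : ℕ} (χ<H : IsIntervalChromaticNumber H r)
  {n k χ : ℕ} {part : Fin n → Fin k} (pc : ProperColouring (CompleteMultipartite n k part) χ)
  (φ : Permutation′ n) (φ-sorted : ∀ x y → φ ⟨$⟩ʳ x Fin.≤ φ ⟨$⟩ʳ y → proj₁ pc x Fin.≤ proj₁ pc y)
  (t : ℕ) (t≥1 : 1 ≤ t) (T : PerfectTiling H (BlowUp n k part φ t)) where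

  private
    G : Graph
    G = BlowUp n k part φ t
    c : Fin n → Fin χ
    c = proj₁ pc
    copies : ℕ
    copies = proj₁ T
    copy : Fin copies → Fin (size H) → Fin (n * t)
    copy = proj₁ (proj₂ T)
    embeds : ∀ i → IsOrderedEmbedding H G (copy i)
    embeds = proj₁ (proj₂ (proj₂ T))
    covers : ∀ v → ∃[ i ] ∃[ a ] copy i a ≡ v
    covers = proj₂ (proj₂ (proj₂ (proj₂ T)))

  colour : Fin (n * t) → Fin χ
  colour = c ∘ block t φ

  colour-mono : ∀ v w → v Fin.≤ w → colour v Fin.≤ colour w
  colour-mono v w v≤w = φ-sorted _ _
    (subst₂ Fin._≤_ (sym (inverseʳ φ)) (sym (inverseʳ φ)) (quotient-mono {n} t v w v≤w))

  copyColouring : Fin copies → MonotoneColouring H χ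
  copyColouring i =
    (colour ∘ copy i , λ a b ab → proj₂ pc _ _ (proj₂ (embeds i) a b ab)) ,
    λ a b a≤b → colour-mono _ _ (IsOrderedEmbedding⇒mono-≤ {H} {G} (embeds i) a b a≤b)

  r≤χ : Fin copies → r ≤ χ
  r≤χ i = IsIntervalChromaticNumber⇒≤ {H} χ<H (copyColouring i)

  n≡0⊎r≤χ : n ≡ 0 ⊎ r ≤ χ
  n≡0⊎r≤χ with n ℕ.≟ 0
  ... | yes n≡0 = inj₁ n≡0
  ... | no n≢0 = inj₂ (r≤χ (proj₁ (covers vertex)))
    where
    vertex : Fin (n * t)
    vertex = fromℕ< (*-mono-≤ (n≢0⇒n>0 n≢0) t≥1)

  copy-meetsEveryColour : χ ≤ r → ∀ j i → ∃[ a ] colour (copy i a) ≡ j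
  copy-meetsEveryColour χ≤r j i with any? (λ a → colour (copy i a) ≟ j)
  ... | yes meets = meets
  ... | no misses = ⊥-elim (<⇒≱ r<χ χ≤r)
    where
    r<χ : r < χ
    r<χ = IsIntervalChromaticNumber⇒<-omitting {H} χ<H (copyColouring i) λ a eq → misses (a , sym eq)

  copies≤ : χ ≤ r → ∀ j → copies ≤ classSize c j * t
  copies≤ χ≤r j =
    perfectTiling-copies≤hittingSet {H} {G} T (λ w → colour w ≡ j) code code-injective
      (copy-meetsEveryColour χ≤r j)
    where
    code : ∀ w → colour w ≡ j → Fin (classSize c j * t)
    code w p = combine (classIndex c p) (remainder {n} t w)
    code-injective : ∀ {v w} p q → code v p ≡ code w q → v ≡ w
    code-injective {v} {w} p q eq = remQuot-injective {n} t (cong₂ _,_ same-quotient same-remainder)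
      where
      same-block : block t φ v ≡ block t φ w
      same-block =
        classIndex-injective c p q (proj₁ (combine-injective _ (remainder {n} t v) _ _ eq))
      same-quotient : quotient {n} t v ≡ quotient {n} t w
      same-quotient = trans (sym (inverseʳ φ)) (trans (cong (φ ⟨$⟩ʳ_) same-block) (inverseʳ φ))
      same-remainder : remainder {n} t v ≡ remainder {n} t w
      same-remainder =
        proj₂ (combine-injective (classIndex c p) _ (classIndex c q) (remainder {n} t w) eq)

  n≤classSize*h : χ ≤ r → ∀ j → n ≤ classSize c j * size H
  n≤classSize*h χ≤r j = *-cancelʳ-≤ n (classSize c j * size H) t {{>-nonZero t≥1}} (begin
    n * t                        ≤⟨ perfectTiling-size {H} {G} T ⟩
    copies * size H              ≤⟨ *-monoˡ-≤ (size H) (copies≤ χ≤r j) ⟩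
    classSize c j * t * size H   ≡⟨ *-assoc (classSize c j) t (size H) ⟩
    classSize c j * (t * size H) ≡⟨ cong (classSize c j *_) (*-comm t (size H)) ⟩
    classSize c j * (size H * t) ≡⟨ *-assoc (classSize c j) (size H) t ⟨
    classSize c j * size H * t   ∎)
    where open ≤-Reasoning

-- (r − 1)h = (r − 1)(h − 1) + (r − 1) ≤ r(h − 1) ≤ (χ − 1)(h − 1), using r ≤ h and r < χ.
bound-if-r<χ : ∀ {r χ h} n s → r ≤ h → r < χ → (r ∸ 1) * h * (n ∸ s) ≤ (χ ∸ 1) * n * (h ∸ 1)
bound-if-r<χ {zero} n s _ _ = z≤n
bound-if-r<χ {suc r} {suc χ} {suc h} n s (s≤s r≤h) (s≤s r<χ) = begin
  r * suc h * (n ∸ s) ≤⟨ *-monoʳ-≤ (r * suc h) (m∸n≤m n s) ⟩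
  r * suc h * n       ≤⟨ *-monoˡ-≤ n weights ⟩
  χ * h * n           ≡⟨ *-assoc χ h n ⟩
  χ * (h * n)         ≡⟨ cong (χ *_) (*-comm h n) ⟩
  χ * (n * h)         ≡⟨ *-assoc χ n h ⟨
  χ * n * h           ∎
  where
  open ≤-Reasoning
  weights : r * suc h ≤ χ * h
  weights = begin
    r * suc h   ≡⟨ *-suc r h ⟩
    r + r * h   ≤⟨ +-monoˡ-≤ (r * h) r≤h ⟩
    suc r * h   ≤⟨ *-monoˡ-≤ h r<χ ⟩
    χ * h       ∎

*-monoˡ-≤-unlessZero : ∀ {a b} n → n ≡ 0 ⊎ a ≤ b → a * n ≤ b * n
*-monoˡ-≤-unlessZero {a} n (inj₁ refl) rewrite *-zeroʳ a = z≤n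
*-monoˡ-≤-unlessZero n (inj₂ a≤b) = *-monoˡ-≤ n a≤b

bound-if-n≤s*h : ∀ {r χ h n s} → n ≤ s * h → n ≡ 0 ⊎ r ≤ χ →
                 (r ∸ 1) * h * (n ∸ s) ≤ (χ ∸ 1) * n * (h ∸ 1)
bound-if-n≤s*h {r} {χ} {h} {n} {s} n≤s*h n≡0⊎r≤χ = begin
  (r ∸ 1) * h * (n ∸ s)   ≡⟨ *-assoc (r ∸ 1) h (n ∸ s) ⟩
  (r ∸ 1) * (h * (n ∸ s)) ≤⟨ *-monoʳ-≤ (r ∸ 1) h*[n∸s]≤n*[h∸1] ⟩
  (r ∸ 1) * (n * (h ∸ 1)) ≡⟨ *-assoc (r ∸ 1) n (h ∸ 1) ⟨
  (r ∸ 1) * n * (h ∸ 1)   ≤⟨ *-monoˡ-≤ (h ∸ 1) [r∸1]*n≤[χ∸1]*n ⟩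
  (χ ∸ 1) * n * (h ∸ 1)   ∎
  where
  open ≤-Reasoning
  h*[n∸s]≤n*[h∸1] : h * (n ∸ s) ≤ n * (h ∸ 1)
  h*[n∸s]≤n*[h∸1] = begin
    h * (n ∸ s)   ≡⟨ *-distribˡ-∸ h n s ⟩
    h * n ∸ h * s ≤⟨ ∸-monoʳ-≤ (h * n) (subst (n ≤_) (*-comm s h) n≤s*h) ⟩
    h * n ∸ n     ≡⟨ cong₂ _∸_ (*-comm h n) (sym (*-identityʳ n)) ⟩
    n * h ∸ n * 1 ≡⟨ *-distribˡ-∸ n h 1 ⟨
    n * (h ∸ 1)   ∎
  [r∸1]*n≤[χ∸1]*n : (r ∸ 1) * n ≤ (χ ∸ 1) * n
  [r∸1]*n≤[χ∸1]*n = *-monoˡ-≤-unlessZero n (map₂ (∸-monoˡ-≤ 1) n≡0⊎r≤χ)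

proposition2p6 : (H : Graph) (r : ℕ) → IsIntervalChromaticNumber H r →
    (n k : ℕ) (part : Fin n → Fin k) → IsBottlegraph H n k part →
    (χ s : ℕ) → IsChromaticNumber (CompleteMultipartite n k part) χ →
    IsSigma (CompleteMultipartite n k part) χ s →
    (r ∸ 1) * size H * (n ∸ s) ≤ (χ ∸ 1) * n * (size H ∸ 1)
proposition2p6 H r χ<H n k part bottle χ s χB ((pc , j , |j|≡s) , _) with χ ≤? r
... | no χ≰r = bound-if-r<χ n s (IsIntervalChromaticNumber⇒≤size {H} χ<H) (≰⇒> χ≰r)
... | yes χ≤r with colourSortedLabelling part χB pc
... | σ , φ , labelling , φ-sorted with bottle σ φ labelling
... | t , t≥1 , T =
  bound-if-n≤s*h {s = s} (subst (λ m → n ≤ m * size H) |j|≡s (n≤classSize*h χ≤r j)) n≡0⊎r≤χ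
  where open ColourSortedBlowUp {H} χ<H {part = part} pc φ φ-sorted t t≥1 T
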